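{- For a finite word $w$ over an alphabet $\Sigma$, $\mathrm{SPAL}(w)=\mathrm{PAL}(w)$ if and only if $w$ is a block word.
   Context: A factor of $w$ is a contiguous subword; a scattered subword is a (not necessarily contiguous) subsequence. A palindrome is a word equal to its reversal. $\mathrm{PAL}(w)$ is the set of non-empty palindromic factors of $w$ and $\mathrm{SPAL}(w)$ the set of non-empty palindromes that are scattered subwords of $w$. A word $w$ is a block word if $w=a_1^{n_1}a_2^{n_2}\cdots a_r^{n_r}$ where the letters $a_1,\dots,a_r\in\Sigma$ are pairwise distinct and $n_i\ge 1$. -}

module Defs where

open import Data.List using (List; []; _∷_; _++_; reverse; map; concatMap; replicate)
open import Data.List.Relation.Binary.Sublist.Propositional using (_⊆_)
open import Data.List.Relation.Unary.All using (All)
open import Data.List.Relation.Unary.Unique.Propositional using (Unique)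
open import Data.Nat using (ℕ; _≥_)
open import Data.Product using (_×_; ∃; ∃-syntax; proj₁; proj₂; _,_)
open import Relation.Binary.PropositionalEquality using (_≡_; _≢_)

Factor : {A : Set} → List A → List A → Set
Factor x w = ∃[ u ] ∃[ v ] (u ++ x ++ v ≡ w)

Scattered : {A : Set} → List A → List A → Set
Scattered x w = x ⊆ w

Palindrome : {A : Set} → List A → Set
Palindrome x = reverse x ≡ x

InPAL : {A : Set} → List A → List A → Set
InPAL w x = x ≢ [] × Palindrome x × Factor x w

InSPAL : {A : Set} → List A → List A → Set
InSPAL w x = x ≢ [] × Palindrome x × Scattered x w

BlockWord : {A : Set} → List A → Set
BlockWord {A} w =
  ∃[ bs ] (All (λ (b : A × ℕ) → proj₂ b ≥ 1) bs
         × Unique (map proj₁ bs)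
         × w ≡ concatMap (λ (b : A × ℕ) → replicate (proj₂ b) (proj₁ b)) bs)

SPALeqPAL : {A : Set} → List A → Set
SPALeqPAL w = (∀ x → InSPAL w x → InPAL w x) × (∀ x → InPAL w x → InSPAL w x)

{-# OPTIONS --safe #-}
module Submission where

-- In a block word, a scattered subword a z a forces z to consist of a's only: once the a-block
-- is left, a never reappears. So a scattered palindrome is a power of a letter, and a scattered
-- power of a fits inside the a-block, where it is a factor. Conversely, powers of a letter are
-- palindromes, so SPAL(w) = PAL(w) makes every scattered power of a letter a factor. Applied to
-- a^(k+1) in a w, where k counts the a's of w, this forces w to begin with a whenever a occurs in
-- w, which is exactly the block-word condition read from the left.

open import Defs
open import Data.Empty using (⊥-elim)
open import Data.List using (List; []; _∷_; _++_; [_]; reverse; map; concatMap; replicate; length; filter; initLast; _∷ʳ′_)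
open import Data.List.Membership.Propositional using (_∈_)
open import Data.List.Membership.Propositional.Properties using (∈-++⁺ʳ)
import Data.List.Membership.DecPropositional as DecMembership
open import Data.List.Properties using (∷-injectiveˡ; ∷-injectiveʳ; ++-assoc; unfold-reverse; reverse-++; filter-all; length-replicate)
open import Data.List.Relation.Binary.Sublist.Propositional using (_⊆_; _∷ʳ_; _∷_; ⊆-refl; from∈)
open import Data.List.Relation.Binary.Sublist.Propositional.Properties using (++⁺ˡ; ++⁺ʳ; ∷⁻; Any-resp-⊆; filter-⊆; filter⁺; length-mono-≤)
open import Data.List.Relation.Unary.All using (All; []; _∷_)
import Data.List.Relation.Unary.All as All
open import Data.List.Relation.Unary.All.Properties using (All¬⇒¬Any; ¬Any⇒All¬; replicate⁺; ++⁺; ++⁻ʳ; all-filter; map⁺; map⁻; concat⁺)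
open import Data.List.Relation.Unary.Any using (here)
open import Data.List.Relation.Unary.AllPairs using ([]; _∷_)
open import Data.List.Relation.Unary.Unique.Propositional using (Unique)
open import Data.Nat using (ℕ; zero; suc; _≤_; _≥_; s≤s; z≤n)
open import Data.Nat.Properties using (n≮n; module ≤-Reasoning)
open import Data.Product using (_×_; ∃-syntax; proj₁; proj₂; _,_; map₂)
open import Data.Sum using (_⊎_; inj₁; inj₂)
open import Relation.Nullary using (¬_; yes; no)
open import Relation.Binary.PropositionalEquality using (_≡_; _≢_; refl; sym; trans; cong; subst; module ≡-Reasoning)
open import Relation.Binary.Definitions using (DecidableEquality)

module _ {A : Set} where

  data Grouped : List A → Set where
    []     : Grouped []
    fresh  : ∀ {c w} → All (c ≢_) w → Grouped w → Grouped (c ∷ w)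
    repeat : ∀ {c w} → Grouped (c ∷ w) → Grouped (c ∷ c ∷ w)

  PowersContiguous : List A → Set
  PowersContiguous w = ∀ a n → replicate n a ⊆ w → Factor (replicate n a) w

  factor-[] : ∀ (w : List A) → Factor [] w
  factor-[] w = [] , w , refl

  prefix⇒factor : ∀ {x v w : List A} → w ≡ x ++ v → Factor x w
  prefix⇒factor {v = v} eq = [] , v , sym eq

  factor⇒sublist : ∀ {x w : List A} → Factor x w → x ⊆ w
  factor⇒sublist (u , v , refl) = ++⁺ˡ u (++⁺ʳ v ⊆-refl)

  factor-∷⁺ : ∀ {c : A} {x w} → Factor x w → Factor x (c ∷ w)
  factor-∷⁺ {c} (u , v , eq) = c ∷ u , v , cong (c ∷_) eq

  factor-∷⁻ : ∀ {c : A} {x w} → Factor x (c ∷ w) → (∃[ v ] c ∷ w ≡ x ++ v) ⊎ Factor x w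
  factor-∷⁻ ([] , v , eq) = inj₁ (v , sym eq)
  factor-∷⁻ (_ ∷ u , v , eq) = inj₂ (u , v , ∷-injectiveʳ eq)

  factor-∷ˡ⁻ : ∀ {y : A} {x w} → Factor (y ∷ x) w → Factor x w
  factor-∷ˡ⁻ {y} {x} (u , v , eq) = u ++ [ y ] , v , trans (++-assoc u [ y ] (x ++ v)) eq

  PAL⊆SPAL : ∀ {w : List A} x → InPAL w x → InSPAL w x
  PAL⊆SPAL x (x≢[] , pal , fac) = x≢[] , pal , factor⇒sublist fac

  replicate-∷ʳ : ∀ n (a : A) → replicate n a ++ [ a ] ≡ a ∷ replicate n a
  replicate-∷ʳ zero a = refl
  replicate-∷ʳ (suc n) a = cong (a ∷_) (replicate-∷ʳ n a)

  reverse-replicate : ∀ n (a : A) → reverse (replicate n a) ≡ replicate n a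
  reverse-replicate zero a = refl
  reverse-replicate (suc n) a = begin
    reverse (a ∷ replicate n a)       ≡⟨ unfold-reverse a (replicate n a) ⟩
    reverse (replicate n a) ++ [ a ]  ≡⟨ cong (_++ [ a ]) (reverse-replicate n a) ⟩
    replicate n a ++ [ a ]            ≡⟨ replicate-∷ʳ n a ⟩
    a ∷ replicate n a                 ∎
    where open ≡-Reasoning

  all≡⇒replicate : ∀ {a : A} xs → All (a ≡_) xs → xs ≡ replicate (length xs) a
  all≡⇒replicate [] [] = refl
  all≡⇒replicate (x ∷ xs) (refl ∷ ps) = cong (x ∷_) (all≡⇒replicate xs ps)

  palindrome-last≡head : ∀ {a b : A} z → Palindrome (a ∷ z ++ [ b ]) → b ≡ a
  palindrome-last≡head {a} {b} z pal = ∷-injectiveˡ (trans (sym (reverse-++ (a ∷ z) [ b ])) pal)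

  missing⇒¬⊆ : ∀ {c : A} {xs w} → All (c ≢_) w → c ∈ xs → ¬ xs ⊆ w
  missing⇒¬⊆ c∉w c∈xs xs⊆w = All¬⇒¬Any c∉w (Any-resp-⊆ xs⊆w c∈xs)

  grouped-tail : ∀ {c : A} {w} → Grouped (c ∷ w) → Grouped w
  grouped-tail (fresh _ g) = g
  grouped-tail (repeat g) = g

  grouped-run : ∀ {c : A} {w} z → Grouped (c ∷ w) → z ++ [ c ] ⊆ c ∷ w → All (c ≡_) z
  grouped-run [] _ _ = []
  grouped-run (d ∷ z) (fresh c∉w _) (_ ∷ʳ s) = ⊥-elim (missing⇒¬⊆ c∉w (∈-++⁺ʳ (d ∷ z) (here refl)) s)
  grouped-run (d ∷ z) (fresh c∉w _) (_ ∷ s) = ⊥-elim (missing⇒¬⊆ c∉w (∈-++⁺ʳ z (here refl)) s)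
  grouped-run (d ∷ z) (repeat g) (_ ∷ʳ s) = grouped-run (d ∷ z) g s
  grouped-run (d ∷ z) (repeat g) (d≡c ∷ s) = sym d≡c ∷ grouped-run z g s

  grouped-sandwich : ∀ {a : A} {w} z → Grouped w → a ∷ z ++ [ a ] ⊆ w → All (a ≡_) z
  grouped-sandwich z g (_ ∷ʳ s) = grouped-sandwich z (grouped-tail g) s
  grouped-sandwich z g (refl ∷ s) = grouped-run z g (_ ∷ʳ s)

  grouped-palindrome : ∀ {a : A} {w} x → Grouped w → Palindrome (a ∷ x) → a ∷ x ⊆ w → All (a ≡_) x
  grouped-palindrome x g pal s with initLast x
  ... | [] = []
  ... | z ∷ʳ′ b with palindrome-last≡head z pal
  ...   | refl = ++⁺ (grouped-sandwich z g s) (refl ∷ [])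

  grouped-power-prefix : ∀ {a : A} {w} n → Grouped (a ∷ w) → replicate n a ⊆ a ∷ w →
                         ∃[ v ] a ∷ w ≡ replicate n a ++ v
  grouped-power-prefix zero _ _ = _ , refl
  grouped-power-prefix (suc zero) (fresh _ _) _ = _ , refl
  grouped-power-prefix (suc (suc n)) (fresh a∉w _) s = ⊥-elim (missing⇒¬⊆ a∉w (here refl) (∷⁻ s))
  grouped-power-prefix {a} (suc n) (repeat g) s = map₂ (cong (a ∷_)) (grouped-power-prefix n g (∷⁻ s))

  grouped⇒powersContiguous : ∀ {w : List A} → Grouped w → PowersContiguous w
  grouped⇒powersContiguous {w} _ a zero _ = factor-[] w
  grouped⇒powersContiguous g a (suc n) (_ ∷ʳ s) =
    factor-∷⁺ (grouped⇒powersContiguous (grouped-tail g) a (suc n) s)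
  grouped⇒powersContiguous g a (suc n) (refl ∷ s) =
    prefix⇒factor (proj₂ (grouped-power-prefix (suc n) g (refl ∷ s)))

  grouped⇒SPAL⊆PAL : ∀ {w : List A} → Grouped w → ∀ x → InSPAL w x → InPAL w x
  grouped⇒SPAL⊆PAL g [] (x≢[] , _) = ⊥-elim (x≢[] refl)
  grouped⇒SPAL⊆PAL {w} g (a ∷ x) (x≢[] , pal , s) =
    x≢[] , pal , subst (λ y → Factor y w) (sym x≡power)
                   (grouped⇒powersContiguous g a _ (subst (_⊆ w) x≡power s))
    where
    x≡power : a ∷ x ≡ replicate (suc (length x)) a
    x≡power = cong (a ∷_) (all≡⇒replicate x (grouped-palindrome x g pal s))

  grouped⇒SPALeqPAL : ∀ {w : List A} → Grouped w → SPALeqPAL w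
  grouped⇒SPALeqPAL g = grouped⇒SPAL⊆PAL g , PAL⊆SPAL

  block : A × ℕ → List A
  block b = replicate (proj₂ b) (proj₁ b)

  ∉-blocks : ∀ {c : A} bs → All (c ≢_) (map proj₁ bs) → All (c ≢_) (concatMap block bs)
  ∉-blocks bs c∉ = concat⁺ (map⁺ (All.map (replicate⁺ _) (map⁻ c∉)))

  blocks-∉ : ∀ {c : A} bs → All (λ b → proj₂ b ≥ 1) bs →
             All (c ≢_) (concatMap block bs) → All (c ≢_) (map proj₁ bs)
  blocks-∉ [] [] _ = []
  blocks-∉ ((a , suc n) ∷ bs) (_ ∷ pos) (c≢a ∷ c∉) = c≢a ∷ blocks-∉ bs pos (++⁻ʳ (replicate n a) c∉)

  grouped-power : ∀ {c : A} n {w} → All (c ≢_) w → Grouped w → Grouped (replicate (suc n) c ++ w)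
  grouped-power zero c∉w g = fresh c∉w g
  grouped-power (suc n) c∉w g = repeat (grouped-power n c∉w g)

  blocks⇒grouped : ∀ bs → All (λ b → proj₂ b ≥ 1) bs → Unique (map proj₁ bs) →
                   Grouped (concatMap block bs)
  blocks⇒grouped [] [] [] = []
  blocks⇒grouped ((c , suc n) ∷ bs) (_ ∷ pos) (c∉ ∷ u) =
    grouped-power n (∉-blocks bs c∉) (blocks⇒grouped bs pos u)

  blockWord⇒grouped : ∀ {w : List A} → BlockWord w → Grouped w
  blockWord⇒grouped (bs , pos , u , refl) = blocks⇒grouped bs pos u

  grouped⇒blockWord : ∀ {w : List A} → Grouped w → BlockWord w
  grouped⇒blockWord [] = [] , [] , [] , refl
  grouped⇒blockWord (fresh {c} c∉w g) with grouped⇒blockWord g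
  ... | bs , pos , u , refl = (c , 1) ∷ bs , s≤s z≤n ∷ pos , blocks-∉ bs pos c∉w ∷ u , refl
  grouped⇒blockWord (repeat g) with grouped⇒blockWord g
  ... | (a , suc n) ∷ bs , _ ∷ pos , u , refl = (a , suc (suc n)) ∷ bs , s≤s z≤n ∷ pos , u , refl

  SPAL⊆PAL⇒powersContiguous : ∀ {w : List A} → (∀ x → InSPAL w x → InPAL w x) → PowersContiguous w
  SPAL⊆PAL⇒powersContiguous {w} _ a zero _ = factor-[] w
  SPAL⊆PAL⇒powersContiguous spal⊆pal a (suc n) s =
    proj₂ (proj₂ (spal⊆pal (replicate (suc n) a) ((λ ()) , reverse-replicate (suc n) a , s)))

  -- If the factor a^(n+1) of c w sits at the very front, then a = c and a^(n+2) is used instead.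
  powersContiguous-tail : ∀ {c : A} {w} → PowersContiguous (c ∷ w) → PowersContiguous w
  powersContiguous-tail {w = w} _ a zero _ = factor-[] w
  powersContiguous-tail h a (suc n) s with factor-∷⁻ (h a (suc n) (_ ∷ʳ s))
  ... | inj₂ fac = fac
  ... | inj₁ (_ , refl) with factor-∷⁻ (h a (suc (suc n)) (refl ∷ s))
  ...   | inj₁ (_ , eq) = prefix⇒factor (∷-injectiveʳ eq)
  ...   | inj₂ fac = factor-∷ˡ⁻ fac

  maximal-power-prefix : ∀ {c : A} {w} k → PowersContiguous (c ∷ w) →
                         replicate k c ⊆ w → ¬ replicate (suc k) c ⊆ w → ∃[ v ] w ≡ replicate k c ++ v
  maximal-power-prefix {c} k h s maximal with factor-∷⁻ (h c (suc k) (refl ∷ s))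
  ... | inj₁ (v , eq) = v , ∷-injectiveʳ eq
  ... | inj₂ fac = ⊥-elim (maximal (factor⇒sublist fac))

module _ {A : Set} (_≟_ : DecidableEquality A) where

  open DecMembership _≟_ using (_∈?_)

  occurrences : A → List A → ℕ
  occurrences c w = length (filter (c ≟_) w)

  replicate-occurrences-⊆ : ∀ c w → replicate (occurrences c w) c ⊆ w
  replicate-occurrences-⊆ c w =
    subst (_⊆ w) (all≡⇒replicate _ (all-filter (c ≟_) w)) (filter-⊆ (c ≟_) w)

  ⊆⇒≤-occurrences : ∀ {c w} n → replicate n c ⊆ w → n ≤ occurrences c w
  ⊆⇒≤-occurrences {c} {w} n s = begin
    n                                       ≡⟨ sym (length-replicate n) ⟩
    length (replicate n c)                  ≡⟨ cong length (sym (filter-all (c ≟_) (replicate⁺ n refl))) ⟩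
    length (filter (c ≟_) (replicate n c))  ≤⟨ length-mono-≤ (filter⁺ (c ≟_) (c ≟_) (λ { refl p → p }) s) ⟩
    occurrences c w                         ∎
    where open ≤-Reasoning

  powersContiguous-head : ∀ {c w} → PowersContiguous (c ∷ w) → c ∈ w → ∃[ v ] w ≡ c ∷ v
  powersContiguous-head {c} {w} h c∈w =
    starts-with-c (⊆⇒≤-occurrences 1 (from∈ c∈w))
      (maximal-power-prefix _ h (replicate-occurrences-⊆ c w) (λ s → n≮n _ (⊆⇒≤-occurrences _ s)))
    where
    starts-with-c : ∀ {k} → 1 ≤ k → ∃[ v ] w ≡ replicate k c ++ v → ∃[ v ] w ≡ c ∷ v
    starts-with-c (s≤s _) (_ , eq) = _ , eq

  grouped-∷ : ∀ {c w} → Grouped w → PowersContiguous (c ∷ w) → Grouped (c ∷ w)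
  grouped-∷ {c} {w} g h with c ∈? w
  ... | no c∉w = fresh (¬Any⇒All¬ w c∉w) g
  ... | yes c∈w with powersContiguous-head h c∈w
  ...   | _ , refl = repeat g

  powersContiguous⇒grouped : ∀ w → PowersContiguous w → Grouped w
  powersContiguous⇒grouped [] _ = []
  powersContiguous⇒grouped (c ∷ w) h =
    grouped-∷ (powersContiguous⇒grouped w (powersContiguous-tail h)) h

corollary3p7 : {A : Set} → DecidableEquality A → (w : List A) →
    (SPALeqPAL w → BlockWord w) × (BlockWord w → SPALeqPAL w)
corollary3p7 _≟_ w =
    (λ spal≡pal → grouped⇒blockWord
                     (powersContiguous⇒grouped _≟_ w (SPAL⊆PAL⇒powersContiguous (proj₁ spal≡pal))))
  , (λ blockWord → grouped⇒SPALeqPAL (blockWord⇒grouped blockWord))
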